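{- Let $H$ be a graph with at least one vertex and $X$ a graph with at least one vertex. Then $G=H\circ X$ is a $1$-König–Egerváry graph if and only if either (i) $H=K_1$ (so $G=K_1\circ X$), and either $X$ is a $1$-König–Egerváry graph without a perfect matching or $X$ is a König–Egerváry graph with a perfect matching; or (ii) $H=K_2$ (so $G=K_2\circ X$), and $X$ is a König–Egerváry graph with a perfect matching.
   Context: All graphs are finite, simple and undirected. $n(G)$, $\alpha(G)$, $\mu(G)$ denote the number of vertices, independence number and maximum matching size. $G$ is König–Egerváry if $\alpha(G)+\mu(G)=n(G)$, and $1$-König–Egerváry if $\alpha(G)+\mu(G)=n(G)-1$. The corona $H\circ X$ is obtained from $H$ by taking, for each vertex $v$ of $H$, a disjoint copy of $X$ and joining $v$ to all vertices of that copy. -}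

module Defs where

open import Data.Nat using (ℕ; zero; suc; _+_; _*_; _≤_)
open import Data.Bool using (Bool; true; false; _∧_)
open import Data.Fin using (Fin; zero; suc; remQuot; _≟_)
open import Data.Product using (_×_; _,_; proj₁; proj₂; ∃; ∃-syntax)
open import Data.List using (List; []; _∷_; length; concatMap)
open import Data.List.Membership.Propositional using (_∈_)
open import Data.List.Relation.Unary.All using (All)
open import Data.List.Relation.Unary.Unique.Propositional using (Unique)
open import Relation.Binary.PropositionalEquality using (_≡_; refl; sym)
open import Relation.Nullary using (¬_; yes; no)
open import Relation.Nullary.Decidable using (⌊_⌋)
open import Data.Empty using (⊥-elim)

record Graph : Set where
  field
    n      : ℕ
    adj    : Fin n → Fin n → Bool
    adj-sym : ∀ u v → adj u v ≡ adj v u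
    irrefl : ∀ u → adj u u ≡ false
open Graph public

IsIndependent : (G : Graph) → List (Fin (n G)) → Set
IsIndependent G S = Unique S × (∀ u v → u ∈ S → v ∈ S → adj G u v ≡ false)

IsIndependenceNumber : Graph → ℕ → Set
IsIndependenceNumber G k =
  (∃[ S ] (IsIndependent G S × length S ≡ k)) ×
  (∀ S → IsIndependent G S → length S ≤ k)

endpoints : {m : ℕ} → List (Fin m × Fin m) → List (Fin m)
endpoints = concatMap (λ e → proj₁ e ∷ proj₂ e ∷ [])

IsMatching : (G : Graph) → List (Fin (n G) × Fin (n G)) → Set
IsMatching G M = All (λ e → adj G (proj₁ e) (proj₂ e) ≡ true) M × Unique (endpoints M)

IsMatchingNumber : Graph → ℕ → Set
IsMatchingNumber G k =
  (∃[ M ] (IsMatching G M × length M ≡ k)) ×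
  (∀ M → IsMatching G M → length M ≤ k)

HasPerfectMatching : Graph → Set
HasPerfectMatching G = ∃[ M ] (IsMatching G M × 2 * length M ≡ n G)

IsKE : Graph → Set
IsKE G = ∃[ a ] ∃[ m ] (IsIndependenceNumber G a × IsMatchingNumber G m × a + m ≡ n G)

Is1KE : Graph → Set
Is1KE G = ∃[ a ] ∃[ m ] (IsIndependenceNumber G a × IsMatchingNumber G m × suc (a + m) ≡ n G)

IsComplete : Graph → Set
IsComplete G = ∀ u v → ¬ (u ≡ v) → adj G u v ≡ true

-- Vertex set Fin (n H * suc (n X)); a vertex p corresponds,
-- via remQuot, to a pair (v , a) with v a vertex of H and a : Fin (suc (n X)):
-- a = zero is the vertex v of H itself, a = suc i is vertex i of the copy X_v.
module _ {h x : ℕ} (aH : Fin h → Fin h → Bool) (aX : Fin x → Fin x → Bool) where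
  coronaAdj' : Fin h × Fin (suc x) → Fin h × Fin (suc x) → Bool
  coronaAdj' (v , zero)  (w , zero)  = aH v w
  coronaAdj' (v , zero)  (w , suc j) = ⌊ v ≟ w ⌋
  coronaAdj' (v , suc i) (w , zero)  = ⌊ v ≟ w ⌋
  coronaAdj' (v , suc i) (w , suc j) = ⌊ v ≟ w ⌋ ∧ aX i j

private
  ≟-sym : ∀ {h} (v w : Fin h) → ⌊ v ≟ w ⌋ ≡ ⌊ w ≟ v ⌋
  ≟-sym v w with v ≟ w | w ≟ v
  ... | yes _ | yes _ = refl
  ... | no _  | no _  = refl
  ... | yes p | no q  = ⊥-elim (q (sym p))
  ... | no p  | yes q = ⊥-elim (p (sym q))

  ≟-refl : ∀ {h} (v : Fin h) → ⌊ v ≟ v ⌋ ≡ true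
  ≟-refl v with v ≟ v
  ... | yes _ = refl
  ... | no p  = ⊥-elim (p refl)

module _ (H X : Graph) where
  private
    sym' : ∀ p q → coronaAdj' (adj H) (adj X) p q ≡ coronaAdj' (adj H) (adj X) q p
    sym' (v , zero)  (w , zero)  = adj-sym H v w
    sym' (v , zero)  (w , suc j) = ≟-sym v w
    sym' (v , suc i) (w , zero)  = ≟-sym v w
    sym' (v , suc i) (w , suc j) rewrite ≟-sym v w | adj-sym X i j = refl

    irr' : ∀ p → coronaAdj' (adj H) (adj X) p p ≡ false
    irr' (v , zero)  = irrefl H v
    irr' (v , suc i) rewrite ≟-refl v | irrefl X i = refl

  corona : Graph
  corona = record
    { n      = n H * suc (n X)
    ; adj    = λ p q → coronaAdj' (adj H) (adj X) (remQuot (suc (n X)) p) (remQuot (suc (n X)) q)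
    ; adj-sym = λ p q → sym' (remQuot (suc (n X)) p) (remQuot (suc (n X)) q)
    ; irrefl = λ p → irr' (remQuot (suc (n X)) p)
    }

{-# OPTIONS --safe #-}
-- Write h = n(H), x = n(X), a = α(X) and m = μ(X). An independent set of H ∘ X meets each block
-- {v} ∪ X_v in at most a vertices (a ≥ 1 because x ≥ 1), so α(H ∘ X) = h a.
-- If X has no perfect matching, an unmatched vertex of each copy X_v can be matched to v; conversely
-- a matching of H ∘ X has at most one edge at each vertex of H and otherwise matches inside the copies,
-- so μ(H ∘ X) = h (m + 1) and the 1-KE equation 1 + h a + h (m + 1) = h (x + 1) forces h ∣ 1.
-- If X has a perfect matching, then x = 2m and a ≤ m. Doubling the 1-KE equation and using
-- 2 μ(H ∘ X) ≤ h (2m + 1) gives h (2m + 1) ≤ 2 + 2 h a, hence a = m and h ≤ 2. For h = 2 this makes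
-- μ(H ∘ X) = 2m + 1, which needs an edge between the two vertices of H. Conversely the copies of a
-- perfect matching of X, plus that edge when h = 2, form a matching missing only one vertex.
module Submission where

open import Defs
open import Data.Nat using (_≥_)
open import Data.Product using (_×_)
open import Data.Sum using (_⊎_)
open import Relation.Binary.PropositionalEquality using (_≡_)
open import Relation.Nullary using (¬_)
open import Function.Bundles using (_⇔_; mk⇔; Equivalence)

open import Data.Nat using (ℕ; zero; suc; _+_; _*_; _≤_; _<_; z≤n; s≤s; s≤s⁻¹)
open import Data.Nat.Properties
open import Data.Nat.Divisibility using (_∣_; ∣m+n∣m⇒∣n; ∣m∣n⇒∣m+n; ∣1⇒≡1; m∣m*n)
open import Data.Nat.Tactic.RingSolver using (solve-∀)
import Data.Bool as Bool
import Data.Bool.Properties as Boolₚ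
open import Data.Bool using (Bool; true; false; _∧_)
open import Data.Fin as Fin using (Fin; zero; suc; combine; remQuot)
import Data.Fin.Properties as Finₚ
open import Data.List using (List; []; _∷_; _++_; length; map; concatMap; allFin; filter; cartesianProduct)
open import Data.List.Properties using (length-map; length-++; length-tabulate; map-∘; concatMap-++; concatMap-cong)
open import Data.List.Relation.Unary.All as All using (All; []; _∷_)
import Data.List.Relation.Unary.All.Properties as Allₚ
open import Data.List.Relation.Unary.Any as Any using (here; there)
open import Data.List.Membership.Propositional using (_∈_; _∉_; find; lose)
open import Data.List.Membership.Propositional.Properties
  using (∈-allFin; ∈-map⁺; ∈-map⁻; ∈-filter⁻; ∈-concatMap⁺; ∈-concatMap⁻; ∈-cartesianProduct⁺)
import Data.List.Membership.DecPropositional as DecMembership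
open import Data.List.Relation.Unary.Unique.Propositional using (Unique)
import Data.List.Relation.Unary.Unique.Propositional.Properties as Uniqueₚ
import Data.List.Relation.Unary.Unique.DecPropositional as DecUnique
open import Data.List.Relation.Unary.AllPairs using ([]; _∷_)
open import Data.Product using (_,_; proj₁; proj₂; ∃-syntax; Σ-syntax)
open import Data.Sum using (inj₁; inj₂; [_,_]′)
open import Data.Empty using (⊥)
open import Relation.Nullary using (Dec; yes; no; ¬?; contradiction)
open import Relation.Nullary.Decidable using (⌊_⌋; _×-dec_; _⊎-dec_; map′)
open import Relation.Unary using (Decidable)
open import Relation.Binary.PropositionalEquality
  using (_≢_; refl; sym; trans; cong; cong₂; subst; subst₂; module ≡-Reasoning)
open import Function using (_∘_; id; case_of_)

-- Counting and enumerating lists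

length-allFin : ∀ k → length (allFin k) ≡ k
length-allFin k = length-tabulate id

module _ {A : Set} where

  private
    delete : ∀ {p : A} B → p ∈ B → List A
    delete (_ ∷ B) (here _)  = B
    delete (b ∷ B) (there i) = b ∷ delete B i

    length-delete : ∀ {p : A} B (i : p ∈ B) → length B ≡ suc (length (delete B i))
    length-delete (_ ∷ B) (here _)  = refl
    length-delete (b ∷ B) (there i) = cong suc (length-delete B i)

    ∈-delete : ∀ {p q : A} B (i : p ∈ B) → q ∈ B → p ≢ q → q ∈ delete B i
    ∈-delete (_ ∷ B) (here refl) (here refl) p≢q = contradiction refl p≢q
    ∈-delete (_ ∷ B) (here _)    (there j)   _   = j
    ∈-delete (_ ∷ B) (there i)   (here q≡b)  _   = here q≡b
    ∈-delete (_ ∷ B) (there i)   (there j)   p≢q = there (∈-delete B i j p≢q)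

  Unique-⊆⇒length≤ : ∀ {S B : List A} → Unique S → All (_∈ B) S → length S ≤ length B
  Unique-⊆⇒length≤ {[]}            []          []          = z≤n
  Unique-⊆⇒length≤ {p ∷ S} {B} (p∉S ∷ uniqS) (p∈B ∷ S⊆B) = begin
    suc (length S)              ≤⟨ s≤s (Unique-⊆⇒length≤ uniqS S⊆B-p) ⟩
    suc (length (delete B p∈B)) ≡⟨ length-delete B p∈B ⟨
    length B                    ∎
    where
      open ≤-Reasoning
      S⊆B-p : All (_∈ delete B p∈B) S
      S⊆B-p = All.zipWith (λ (q∈B , p≢q) → ∈-delete B p∈B q∈B p≢q) (S⊆B , p∉S)

Unique⇒length≤ : ∀ {k} {S : List (Fin k)} → Unique S → length S ≤ k
Unique⇒length≤ {k} {S} uniqS = subst (length S ≤_) (length-allFin k)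
  (Unique-⊆⇒length≤ uniqS (All.tabulate (λ {i} _ → ∈-allFin i)))

length<⇒∃∉ : ∀ {k} (E : List (Fin k)) → length E < k → ∃[ r ] r ∉ E
length<⇒∃∉ {k} E |E|<k =
  Finₚ.¬∀⟶∃¬ k (_∈ E) (λ i → DecMembership._∈?_ Fin._≟_ i E) covers⇒k≤|E|
  where
    covers⇒k≤|E| : ¬ (∀ i → i ∈ E)
    covers⇒k≤|E| covers = <⇒≱ |E|<k (subst (_≤ length E) (length-allFin k)
      (Unique-⊆⇒length≤ (Uniqueₚ.allFin⁺ k) (All.tabulate (λ {i} _ → covers i))))

module _ {A B : Set} {Q : A → Set} (f : A → B)
         (f-injectiveOn : ∀ {p q} → Q p → Q q → f p ≡ f q → p ≡ q) where

  Unique-map-injectiveOn : ∀ {S} → Unique S → All Q S → Unique (map f S)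
  Unique-map-injectiveOn []             []         = []
  Unique-map-injectiveOn (p∉S ∷ uniqS) (Qp ∷ QS) =
    Allₚ.map⁺ (All.zipWith (λ (p≢q , Qq) → p≢q ∘ f-injectiveOn Qp Qq) (p∉S , QS))
      ∷ Unique-map-injectiveOn uniqS QS

length≤-injectiveOn : ∀ {A : Set} {k} {Q : A → Set} (f : A → Fin k) →
  (∀ {p q} → Q p → Q q → f p ≡ f q → p ≡ q) →
  ∀ {S} → Unique S → All Q S → length S ≤ k
length≤-injectiveOn f f-injectiveOn {S} uniqS QS = subst (_≤ _) (length-map f S)
  (Unique⇒length≤ (Unique-map-injectiveOn f f-injectiveOn uniqS QS))

module _ {A : Set} {P : A → Set} (P? : Decidable P) where

  length-filter-split : ∀ S → length S ≡ length (filter P? S) + length (filter (¬? ∘ P?) S)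
  length-filter-split []      = refl
  length-filter-split (p ∷ S) with P? p
  ... | yes _ = cong suc (length-filter-split S)
  ... | no  _ = trans (cong suc (length-filter-split S)) (sym (+-suc _ _))

module _ {A : Set} {k : ℕ} (block : A → Fin k) (Good : List A → Set)
         (Good-filter : ∀ {P : A → Set} (P? : Decidable P) {S} → Good S → Good (filter P? S))
         (c : ℕ) (blockwise : ∀ v {T} → Good T → All (λ p → block p ≡ v) T → length T ≤ c) where

  private
    within : ∀ vs {S} → Good S → All (λ p → block p ∈ vs) S → length S ≤ length vs * c
    within []       {[]}    _     _          = z≤n
    within []       {_ ∷ _} _     (() ∷ _)
    within (v ∷ vs) {S}     goodS S⊆v∷vs = begin
      length S                                             ≡⟨ length-filter-split inV? S ⟩
      length (filter inV? S) + length (filter (¬? ∘ inV?) S) ≤⟨ +-mono-≤ inside outside ⟩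
      c + length vs * c                                    ∎
      where
        open ≤-Reasoning
        inV? : Decidable (λ p → block p ≡ v)
        inV? p = block p Fin.≟ v
        inside : length (filter inV? S) ≤ c
        inside = blockwise v (Good-filter inV? goodS) (Allₚ.all-filter inV? S)
        in-vs : ∀ {p} → ¬ block p ≡ v × block p ∈ v ∷ vs → block p ∈ vs
        in-vs (≢v , here ≡v) = contradiction ≡v ≢v
        in-vs (_  , there i) = i
        outside : length (filter (¬? ∘ inV?) S) ≤ length vs * c
        outside = within vs (Good-filter (¬? ∘ inV?) goodS)
          (All.zipWith in-vs (Allₚ.all-filter (¬? ∘ inV?) S , Allₚ.filter⁺ (¬? ∘ inV?) S⊆v∷vs))

  blockwise⇒length≤ : ∀ {S} → Good S → length S ≤ k * c
  blockwise⇒length≤ {S} goodS = subst (λ l → length S ≤ l * c) (length-allFin k)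
    (within (allFin k) goodS (All.tabulate (λ {p} _ → ∈-allFin (block p))))

module _ {A B : Set} (f : A → List B) where

  length-concatMap-const : ∀ {c} → (∀ v → length (f v) ≡ c) →
    ∀ vs → length (concatMap f vs) ≡ length vs * c
  length-concatMap-const |f|≡c []       = refl
  length-concatMap-const |f|≡c (v ∷ vs) =
    trans (length-++ (f v)) (cong₂ _+_ (|f|≡c v) (length-concatMap-const |f|≡c vs))

  Unique-concatMap-blocks : (block : B → A) → (∀ v → All (λ p → block p ≡ v) (f v)) →
    (∀ v → Unique (f v)) → ∀ {vs} → Unique vs → Unique (concatMap f vs)
  Unique-concatMap-blocks block f⊆v uniq-f {[]}     []             = []
  Unique-concatMap-blocks block f⊆v uniq-f {v ∷ vs} (v∉vs ∷ uniqVs) =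
    Uniqueₚ.++⁺ (uniq-f v) (Unique-concatMap-blocks block f⊆v uniq-f uniqVs) disjoint
    where
      disjoint : ∀ {p} → p ∈ f v × p ∈ concatMap f vs → ⊥
      disjoint (p∈fv , p∈rest) with find (∈-concatMap⁻ f {xs = vs} p∈rest)
      ... | w , w∈vs , p∈fw =
        All.lookup v∉vs w∈vs (trans (sym (All.lookup (f⊆v v) p∈fv)) (All.lookup (f⊆v w) p∈fw))

module _ {A : Set} where

  listsOfLength : ℕ → List A → List (List A)
  listsOfLength zero    U = [] ∷ []
  listsOfLength (suc k) U = concatMap (λ p → map (p ∷_) (listsOfLength k U)) U

  ∈-listsOfLength : ∀ {U} (S : List A) → All (_∈ U) S → S ∈ listsOfLength (length S) U
  ∈-listsOfLength []      []           = here refl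
  ∈-listsOfLength (p ∷ S) (p∈U ∷ S⊆U) =
    ∈-concatMap⁺ _ (Any.map (λ { refl → ∈-map⁺ (p ∷_) (∈-listsOfLength S S⊆U) }) p∈U)

  module _ {Good : List A → Set} (good? : ∀ S → Dec (Good S))
           (U : List A) (Good⇒⊆U : ∀ {S} → Good S → All (_∈ U) S) where

    private
      ∃-ofLength? : ∀ k → Dec (∃[ S ] (Good S × length S ≡ k))
      ∃-ofLength? k with Any.any? (λ S → good? S ×-dec (length S ≟ k)) (listsOfLength k U)
      ... | yes found = let (S , _ , goodS , |S|≡k) = find found in yes (S , goodS , |S|≡k)
      ... | no  none  = no λ { (S , goodS , refl) →
        none (lose (∈-listsOfLength S (Good⇒⊆U goodS)) (goodS , refl)) }

      largest≤ : ∀ b → ∃[ S ] (Good S × length S ≡ 0) → (∀ {S} → Good S → length S ≤ b) →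
        ∃[ k ] ((∃[ S ] (Good S × length S ≡ k)) × (∀ S → Good S → length S ≤ k))
      largest≤ b ∃₀ bound with ∃-ofLength? b
      ... | yes ∃b = b , ∃b , λ S → bound
      largest≤ zero    ∃₀ bound | no ¬∃b = contradiction ∃₀ ¬∃b
      largest≤ (suc b) ∃₀ bound | no ¬∃b = largest≤ b ∃₀ bound′
        where
          bound′ : ∀ {S} → Good S → length S ≤ b
          bound′ {S} goodS with m≤n⇒m<n∨m≡n (bound goodS)
          ... | inj₁ (s≤s |S|≤b) = |S|≤b
          ... | inj₂ |S|≡1+b     = contradiction (S , goodS , |S|≡1+b) ¬∃b

    maximumSize-exists : Good [] → ∀ b → (∀ {S} → Good S → length S ≤ b) →
      ∃[ k ] ((∃[ S ] (Good S × length S ≡ k)) × (∀ S → Good S → length S ≤ k))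
    maximumSize-exists good[] b = largest≤ b ([] , good[] , refl)

-- Independence and matching numbers

true≢false : true ≢ false
true≢false ()

2*m≤1+2*n⇒m≤n : ∀ {m n} → 2 * m ≤ suc (2 * n) → m ≤ n
2*m≤1+2*n⇒m≤n {m} {n} 2m≤1+2n =
  s≤s⁻¹ (*-cancelˡ-< 2 m (suc n) (subst (suc (2 * m) ≤_) (sym (*-suc 2 n)) (s≤s 2m≤1+2n)))

module _ {m : ℕ} where

  length-endpoints : ∀ (M : List (Fin m × Fin m)) → length (endpoints M) ≡ 2 * length M
  length-endpoints []      = refl
  length-endpoints (_ ∷ M) = trans (cong (λ l → suc (suc l)) (length-endpoints M)) (sym (*-suc 2 (length M)))

  ∈-endpoints : ∀ {M e} {p : Fin m} → e ∈ M → p ≡ proj₁ e ⊎ p ≡ proj₂ e → p ∈ endpoints M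
  ∈-endpoints e∈M (inj₁ p≡e₁) = ∈-concatMap⁺ _ (lose e∈M (here p≡e₁))
  ∈-endpoints e∈M (inj₂ p≡e₂) = ∈-concatMap⁺ _ (lose e∈M (there (here p≡e₂)))

  endpoints-⊆ : ∀ {M M′ : List (Fin m × Fin m)} → (∀ {e} → e ∈ M′ → e ∈ M) →
    ∀ {p} → p ∈ endpoints M′ → p ∈ endpoints M
  endpoints-⊆ {M′ = M′} M′⊆M p∈M′ with find (∈-concatMap⁻ _ {xs = M′} p∈M′)
  ... | e , e∈M′ , here p≡e₁         = ∈-endpoints (M′⊆M e∈M′) (inj₁ p≡e₁)
  ... | e , e∈M′ , there (here p≡e₂) = ∈-endpoints (M′⊆M e∈M′) (inj₂ p≡e₂)

  All-endpoints : ∀ {P : Fin m → Set} {M} →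
    All (λ e → P (proj₁ e) × P (proj₂ e)) M → All P (endpoints M)
  All-endpoints []                = []
  All-endpoints ((P₁ , P₂) ∷ PM) = P₁ ∷ P₂ ∷ All-endpoints PM

  Unique-endpoints-filter : ∀ {P : Fin m × Fin m → Set} (P? : Decidable P) M →
    Unique (endpoints M) → Unique (endpoints (filter P? M))
  Unique-endpoints-filter P? []      uniq = uniq
  Unique-endpoints-filter P? (e ∷ M) ((e₁∉ ∷ e₁∉M) ∷ (e₂∉M ∷ uniqM)) with P? e
  ... | yes _ = (e₁∉ ∷ restrict e₁∉M) ∷ (restrict e₂∉M ∷ Unique-endpoints-filter P? M uniqM)
    where
      restrict : ∀ {p} → All (p ≢_) (endpoints M) → All (p ≢_) (endpoints (filter P? M))
      restrict p∉M = All.tabulate (All.lookup p∉M ∘ endpoints-⊆ (proj₁ ∘ ∈-filter⁻ P? {xs = M}))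
  ... | no _  = Unique-endpoints-filter P? M uniqM

  Unique-map-endpoint : (f : Fin m × Fin m → Fin m) → (∀ e → f e ≡ proj₁ e ⊎ f e ≡ proj₂ e) →
    ∀ M → Unique (endpoints M) → Unique (map f M)
  Unique-map-endpoint f f-endpoint []      _ = []
  Unique-map-endpoint f f-endpoint (e ∷ M) ((e₁∉ ∷ e₁∉M) ∷ (e₂∉M ∷ uniqM)) =
    All.tabulate f[e]∉ ∷ Unique-map-endpoint f f-endpoint M uniqM
    where
      f[e]∉ : ∀ {p} → p ∈ map f M → f e ≢ p
      f[e]∉ p∈fM f[e]≡p with ∈-map⁻ f p∈fM
      ... | e′ , e′∈M , refl = [ avoids e₁∉M , avoids e₂∉M ]′ (f-endpoint e)
        where
          avoids : ∀ {q} → All (q ≢_) (endpoints M) → f e ≡ q → ⊥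
          avoids q∉M f[e]≡q = All.lookup q∉M (∈-endpoints e′∈M (f-endpoint e′)) (trans (sym f[e]≡q) f[e]≡p)

mapEdge : ∀ {m m′} → (Fin m → Fin m′) → Fin m × Fin m → Fin m′ × Fin m′
mapEdge f e = f (proj₁ e) , f (proj₂ e)

endpoints-map : ∀ {m m′} (f : Fin m → Fin m′) M → endpoints (map (mapEdge f) M) ≡ map f (endpoints M)
endpoints-map f []      = refl
endpoints-map f (e ∷ M) = cong (λ E → f (proj₁ e) ∷ f (proj₂ e) ∷ E) (endpoints-map f M)

IsMatching-filter : ∀ (Y : Graph) {P : Fin (n Y) × Fin (n Y) → Set} (P? : Decidable P) {M} →
  IsMatching Y M → IsMatching Y (filter P? M)
IsMatching-filter Y P? {M} (edges , uniq) = Allₚ.filter⁺ P? edges , Unique-endpoints-filter P? M uniq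

IsIndependent-filter : ∀ (Y : Graph) {P : Fin (n Y) → Set} (P? : Decidable P) {S} →
  IsIndependent Y S → IsIndependent Y (filter P? S)
IsIndependent-filter Y P? {S} (uniq , indep) = Uniqueₚ.filter⁺ P? uniq ,
  λ u v u∈ v∈ → indep u v (proj₁ (∈-filter⁻ P? {xs = S} u∈)) (proj₁ (∈-filter⁻ P? {xs = S} v∈))

singleton-independent : ∀ (Y : Graph) z → IsIndependent Y (z ∷ [])
singleton-independent Y z = ([] ∷ []) , λ { _ _ (here refl) (here refl) → irrefl Y z }

endpoints-concatMap : ∀ {A : Set} {m} (f : A → List (Fin m × Fin m)) vs →
  endpoints (concatMap f vs) ≡ concatMap (endpoints ∘ f) vs
endpoints-concatMap f []       = refl
endpoints-concatMap f (v ∷ vs) =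
  trans (concatMap-++ _ (f v) (concatMap f vs)) (cong (endpoints (f v) ++_) (endpoints-concatMap f vs))

module _ (Y : Graph) where

  independent? : ∀ S → Dec (IsIndependent Y S)
  independent? S = DecUnique.unique? Fin._≟_ S ×-dec map′ pairwise tabulated
    (All.all? (λ u → All.all? (λ v → adj Y u v Bool.≟ false) S) S)
    where
      AllPairsNonadjacent : Set
      AllPairsNonadjacent = All (λ u → All (λ v → adj Y u v ≡ false) S) S
      pairwise : AllPairsNonadjacent → ∀ u v → u ∈ S → v ∈ S → adj Y u v ≡ false
      pairwise nonadj u v u∈S v∈S = All.lookup (All.lookup nonadj u∈S) v∈S
      tabulated : (∀ u v → u ∈ S → v ∈ S → adj Y u v ≡ false) → AllPairsNonadjacent
      tabulated nonadj = All.tabulate (λ u∈S → All.tabulate (nonadj _ _ u∈S))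

  matching? : ∀ M → Dec (IsMatching Y M)
  matching? M = All.all? (λ e → adj Y (proj₁ e) (proj₂ e) Bool.≟ true) M
    ×-dec DecUnique.unique? Fin._≟_ (endpoints M)

  matching⇒2*length≤n : ∀ {M} → IsMatching Y M → 2 * length M ≤ n Y
  matching⇒2*length≤n {M} (_ , uniq) = subst (_≤ n Y) (length-endpoints M) (Unique⇒length≤ uniq)

  independenceNumber-exists : ∃[ a ] IsIndependenceNumber Y a
  independenceNumber-exists = maximumSize-exists independent? (allFin (n Y))
    (λ _ → All.tabulate (λ {i} _ → ∈-allFin i))
    ([] , λ _ _ ())
    (n Y) (λ indS → Unique⇒length≤ (proj₁ indS))

  matchingNumber-exists : ∃[ m ] IsMatchingNumber Y m
  matchingNumber-exists = maximumSize-exists matching? (cartesianProduct (allFin (n Y)) (allFin (n Y)))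
    (λ _ → All.tabulate (λ {e} _ → ∈-cartesianProduct⁺ (∈-allFin (proj₁ e)) (∈-allFin (proj₂ e))))
    ([] , [])
    (n Y) (λ {M} matchM → ≤-trans (m≤n*m (length M) 2) (matching⇒2*length≤n matchM))

  independent+matching≤n : ∀ {S M} → IsIndependent Y S → IsMatching Y M → length S + length M ≤ n Y
  -- Every edge of M has an endpoint outside S, and these endpoints are distinct.
  independent+matching≤n {S} {M} (uniqS , indS) (edges , uniqM) = begin
    length S + length M               ≡⟨ cong (length S +_) (length-map outside M) ⟨
    length S + length (map outside M) ≡⟨ length-++ S ⟨
    length (S ++ map outside M)       ≤⟨ Unique⇒length≤ (Uniqueₚ.++⁺ uniqS uniq-outside disjoint) ⟩
    n Y                               ∎
    where
      open ≤-Reasoning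
      outside : Fin (n Y) × Fin (n Y) → Fin (n Y)
      outside (u , v) with DecMembership._∈?_ Fin._≟_ u S
      ... | yes _ = v
      ... | no  _ = u
      outside-endpoint : ∀ e → outside e ≡ proj₁ e ⊎ outside e ≡ proj₂ e
      outside-endpoint (u , v) with DecMembership._∈?_ Fin._≟_ u S
      ... | yes _ = inj₂ refl
      ... | no  _ = inj₁ refl
      outside∉S : ∀ {e} → adj Y (proj₁ e) (proj₂ e) ≡ true → outside e ∉ S
      outside∉S {u , v} uv with DecMembership._∈?_ Fin._≟_ u S
      ... | yes u∈S = λ v∈S → true≢false (trans (sym uv) (indS u v u∈S v∈S))
      ... | no  u∉S = u∉S
      uniq-outside : Unique (map outside M)
      uniq-outside = Unique-map-endpoint outside outside-endpoint M uniqM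
      disjoint : ∀ {p} → p ∈ S × p ∈ map outside M → ⊥
      disjoint (p∈S , p∈M) with ∈-map⁻ outside p∈M
      ... | e , e∈M , refl = outside∉S (All.lookup edges e∈M) p∈S

  independenceNumber-unique : ∀ {a b} → IsIndependenceNumber Y a → IsIndependenceNumber Y b → a ≡ b
  independenceNumber-unique ((S , indS , refl) , maxA) ((T , indT , refl) , maxB) =
    ≤-antisym (maxB S indS) (maxA T indT)

  matchingNumber-unique : ∀ {m μ} → IsMatchingNumber Y m → IsMatchingNumber Y μ → m ≡ μ
  matchingNumber-unique ((M , matchM , refl) , maxM) ((N , matchN , refl) , maxN) =
    ≤-antisym (maxN M matchM) (maxM N matchN)

  α+μ≤n : ∀ {a m} → IsIndependenceNumber Y a → IsMatchingNumber Y m → a + m ≤ n Y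
  α+μ≤n ((S , indS , refl) , _) ((M , matchM , refl) , _) = independent+matching≤n indS matchM

  2μ≤n : ∀ {m} → IsMatchingNumber Y m → 2 * m ≤ n Y
  2μ≤n ((M , matchM , refl) , _) = matching⇒2*length≤n matchM

  perfectMatching⇔2μ≡n : ∀ {m} → IsMatchingNumber Y m → HasPerfectMatching Y ⇔ 2 * m ≡ n Y
  perfectMatching⇔2μ≡n μ@((M , matchM , refl) , maxM) = mk⇔
    (λ (M′ , matchM′ , 2|M′|≡n) → ≤-antisym (2μ≤n μ)
      (subst (_≤ 2 * length M) 2|M′|≡n (*-monoʳ-≤ 2 (maxM M′ matchM′))))
    (λ 2|M|≡n → M , matchM , 2|M|≡n)

  near-perfect⇒matchingNumber : ∀ {M} → IsMatching Y M → n Y ≤ suc (2 * length M) →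
    IsMatchingNumber Y (length M)
  near-perfect⇒matchingNumber {M} matchM n≤1+2|M| = (M , matchM , refl) ,
    λ M′ matchM′ → 2*m≤1+2*n⇒m≤n (≤-trans (matching⇒2*length≤n matchM′) n≤1+2|M|)

Is1KE⇔ : ∀ (Y : Graph) {a m} → IsIndependenceNumber Y a → IsMatchingNumber Y m →
  Is1KE Y ⇔ suc (a + m) ≡ n Y
Is1KE⇔ Y α μ = mk⇔
  (λ (a′ , m′ , α′ , μ′ , eq) → subst₂ (λ a″ m″ → suc (a″ + m″) ≡ n Y)
     (independenceNumber-unique Y α′ α) (matchingNumber-unique Y μ′ μ) eq)
  (λ eq → _ , _ , α , μ , eq)

IsKE⇔ : ∀ (Y : Graph) {a m} → IsIndependenceNumber Y a → IsMatchingNumber Y m →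
  IsKE Y ⇔ a + m ≡ n Y
IsKE⇔ Y α μ = mk⇔
  (λ (a′ , m′ , α′ , μ′ , eq) → subst₂ (λ a″ m″ → a″ + m″ ≡ n Y)
     (independenceNumber-unique Y α′ α) (matchingNumber-unique Y μ′ μ) eq)
  (λ eq → _ , _ , α , μ , eq)

near-perfect⇒1KE : ∀ (Y : Graph) {a M k} → IsIndependenceNumber Y a → IsMatching Y M → length M ≡ k →
  a ≤ k → suc (a + k) ≡ n Y → Is1KE Y
near-perfect⇒1KE Y {a} {M} {k} α matchM refl a≤k eq =
  a , k , α , near-perfect⇒matchingNumber Y matchM n≤1+2k , eq
  where
    open ≤-Reasoning
    n≤1+2k : n Y ≤ suc (2 * k)
    n≤1+2k = begin
      n Y           ≡⟨ eq ⟨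
      suc (a + k)   ≤⟨ s≤s (+-monoˡ-≤ k a≤k) ⟩
      suc (k + k)   ≡⟨ cong (λ t → suc (k + t)) (+-identityʳ k) ⟨
      suc (2 * k)   ∎

-- The corona H ∘ X

module Corona (H X : Graph) where

  private
    K : ℕ
    K = suc (n X)

    ⌊v≟v⌋ : ∀ {k} (v : Fin k) → ⌊ v Fin.≟ v ⌋ ≡ true
    ⌊v≟v⌋ v with v Fin.≟ v
    ... | yes _   = refl
    ... | no  v≢v = contradiction refl v≢v

    ⌊v≟w⌋⇒v≡w : ∀ {k} {v w : Fin k} → ⌊ v Fin.≟ w ⌋ ≡ true → v ≡ w
    ⌊v≟w⌋⇒v≡w {v = v} {w} ⌊v≟w⌋ with v Fin.≟ w
    ... | yes v≡w = v≡w
    ... | no  _   = contradiction (sym ⌊v≟w⌋) true≢false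

  -- Position zero of block v is the vertex v of H, its hub; position suc i is the leaf i of the copy X_v.
  _∼_ : Fin (n H) × Fin K → Fin (n H) × Fin K → Bool
  _∼_ = coronaAdj' (adj H) (adj X)

  ∼-hub-leaf : ∀ v i → (v , zero) ∼ (v , suc i) ≡ true
  ∼-hub-leaf v i = ⌊v≟v⌋ v

  ∼-leaves : ∀ v i j → (v , suc i) ∼ (v , suc j) ≡ adj X i j
  ∼-leaves v i j = cong (_∧ adj X i j) (⌊v≟v⌋ v)

  ∼-leaf-edge : ∀ v i w j → (v , suc i) ∼ (w , suc j) ≡ true → v ≡ w × adj X i j ≡ true
  ∼-leaf-edge v i w j vi∼wj =
    ⌊v≟w⌋⇒v≡w (Boolₚ.∧-conicalˡ _ _ vi∼wj) , Boolₚ.∧-conicalʳ _ _ vi∼wj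

  ∼-edge-within-block : ∀ v a w b → (v , a) ∼ (w , b) ≡ true → (a ≡ zero × b ≡ zero) ⊎ v ≡ w
  ∼-edge-within-block v zero    w zero    _     = inj₁ (refl , refl)
  ∼-edge-within-block v zero    w (suc j) va∼wb = inj₂ (⌊v≟w⌋⇒v≡w va∼wb)
  ∼-edge-within-block v (suc i) w zero    va∼wb = inj₂ (⌊v≟w⌋⇒v≡w va∼wb)
  ∼-edge-within-block v (suc i) w (suc j) va∼wb = inj₂ (proj₁ (∼-leaf-edge v i w j va∼wb))

  Vertex : Set
  Vertex = Fin (n (corona H X))

  vertex : Fin (n H) → Fin K → Vertex
  vertex = combine

  block : Vertex → Fin (n H)
  block p = proj₁ (remQuot {n H} K p)

  position : Vertex → Fin K
  position p = proj₂ (remQuot {n H} K p)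

  block-vertex : ∀ v a → block (vertex v a) ≡ v
  block-vertex v a = cong proj₁ (Finₚ.remQuot-combine v a)

  position-vertex : ∀ v a → position (vertex v a) ≡ a
  position-vertex v a = cong proj₂ (Finₚ.remQuot-combine v a)

  vertex-injective : ∀ {v a w b} → vertex v a ≡ vertex w b → v ≡ w × a ≡ b
  vertex-injective = Finₚ.combine-injective _ _ _ _

  coordinates-injective : ∀ {p q} → block p ≡ block q → position p ≡ position q → p ≡ q
  coordinates-injective {p} {q} block≡ position≡ = begin
    p                             ≡⟨ Finₚ.combine-remQuot {n H} K p ⟨
    vertex (block p) (position p) ≡⟨ cong₂ vertex block≡ position≡ ⟩
    vertex (block q) (position q) ≡⟨ Finₚ.combine-remQuot {n H} K q ⟩
    q                             ∎
    where open ≡-Reasoning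

  adj-at : ∀ {p q v a w b} → block p ≡ v → position p ≡ a → block q ≡ w → position q ≡ b →
    adj (corona H X) p q ≡ (v , a) ∼ (w , b)
  adj-at refl refl refl refl = refl

  adj-vertex : ∀ v a w b → adj (corona H X) (vertex v a) (vertex w b) ≡ (v , a) ∼ (w , b)
  adj-vertex v a w b =
    adj-at (block-vertex v a) (position-vertex v a) (block-vertex w b) (position-vertex w b)

  length-blockwise : ∀ {A : Set} {c} (f : Fin (n H) → List A) → (∀ v → length (f v) ≡ c) →
    length (concatMap f (allFin (n H))) ≡ n H * c
  length-blockwise f |f|≡c =
    trans (length-concatMap-const f |f|≡c (allFin (n H))) (cong (_* _) (length-allFin (n H)))

  everyBlock : List (Fin K) → List Vertex
  everyBlock L = concatMap (λ v → map (vertex v) L) (allFin (n H))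

  length-everyBlock : ∀ L → length (everyBlock L) ≡ n H * length L
  length-everyBlock L = length-blockwise (λ v → map (vertex v) L) (λ v → length-map (vertex v) L)

  ∈-everyBlock⁻ : ∀ {L p} → p ∈ everyBlock L → ∃[ v ] ∃[ a ] (a ∈ L × p ≡ vertex v a)
  ∈-everyBlock⁻ {L} p∈ with find (∈-concatMap⁻ (λ v → map (vertex v) L) {xs = allFin (n H)} p∈)
  ... | v , _ , p∈vL with ∈-map⁻ (vertex v) p∈vL
  ...   | a , a∈L , p≡va = v , a , a∈L , p≡va

  Unique-everyBlock : ∀ {L} → Unique L → Unique (everyBlock L)
  Unique-everyBlock {L} uniqL = Unique-concatMap-blocks (λ v → map (vertex v) L) block
    (λ v → Allₚ.map⁺ (All.tabulate (λ {a} _ → block-vertex v a)))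
    (λ v → Uniqueₚ.map⁺ (proj₂ ∘ vertex-injective) uniqL)
    (Uniqueₚ.allFin⁺ (n H))

  copies-independent : ∀ {S} → IsIndependent X S → IsIndependent (corona H X) (everyBlock (map suc S))
  copies-independent {S} (uniqS , indS) = Unique-everyBlock (Uniqueₚ.map⁺ Finₚ.suc-injective uniqS) , indep
    where
      indep : ∀ p q → p ∈ everyBlock (map suc S) → q ∈ everyBlock (map suc S) →
        adj (corona H X) p q ≡ false
      indep p q p∈ q∈ with ∈-everyBlock⁻ p∈ | ∈-everyBlock⁻ q∈
      ... | v , _ , a∈ , refl | w , _ , b∈ , refl with ∈-map⁻ suc a∈ | ∈-map⁻ suc b∈
      ...   | i , i∈S , refl | j , j∈S , refl = begin
        adj (corona H X) (vertex v (suc i)) (vertex w (suc j)) ≡⟨ adj-vertex v (suc i) w (suc j) ⟩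
        ⌊ v Fin.≟ w ⌋ ∧ adj X i j                             ≡⟨ cong (_ ∧_) (indS i j i∈S j∈S) ⟩
        ⌊ v Fin.≟ w ⌋ ∧ false                                 ≡⟨ Boolₚ.∧-zeroʳ _ ⟩
        false                                                 ∎
        where open ≡-Reasoning

  hub∉everyBlock-leaves : ∀ v {L} → vertex v zero ∉ everyBlock (map suc L)
  hub∉everyBlock-leaves v hub∈ with ∈-everyBlock⁻ hub∈
  ... | w , a , a∈ , hub≡ with ∈-map⁻ suc a∈
  ...   | i , _ , refl with proj₂ (vertex-injective hub≡)
  ...     | ()

  AdjacentPairs : List (Vertex × Vertex) → Set
  AdjacentPairs = All (λ e → adj (corona H X) (proj₁ e) (proj₂ e) ≡ true)

  endpoints-blockwise : ∀ {L} (f : Fin (n H) → List (Vertex × Vertex)) →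
    (∀ v → endpoints (f v) ≡ map (vertex v) L) → endpoints (concatMap f (allFin (n H))) ≡ everyBlock L
  endpoints-blockwise f endpoints-f =
    trans (endpoints-concatMap f (allFin (n H))) (concatMap-cong endpoints-f (allFin (n H)))

  blockwise-matching : ∀ {L} (f : Fin (n H) → List (Vertex × Vertex)) → (∀ v → AdjacentPairs (f v)) →
    (∀ v → endpoints (f v) ≡ map (vertex v) L) → Unique L →
    IsMatching (corona H X) (concatMap f (allFin (n H)))
  blockwise-matching f adjacent endpoints-f uniqL =
    Allₚ.concat⁺ (Allₚ.map⁺ {xs = allFin (n H)} (All.tabulate (λ {v} _ → adjacent v))) ,
    subst Unique (sym (endpoints-blockwise f endpoints-f)) (Unique-everyBlock uniqL)

  liftEdge : Fin (n H) → Fin (n X) × Fin (n X) → Vertex × Vertex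
  liftEdge v = mapEdge (vertex v ∘ suc)

  endpoints-liftEdges : ∀ v M → endpoints (map (liftEdge v) M) ≡ map (vertex v) (map suc (endpoints M))
  endpoints-liftEdges v M = trans (endpoints-map (vertex v ∘ suc) M) (map-∘ (endpoints M))

  liftEdges-adjacent : ∀ v {M} → All (λ e → adj X (proj₁ e) (proj₂ e) ≡ true) M →
    AdjacentPairs (map (liftEdge v) M)
  liftEdges-adjacent v edges = Allₚ.map⁺ (All.map (λ {e} ij →
    trans (adj-vertex v (suc (proj₁ e)) v (suc (proj₂ e))) (trans (∼-leaves v _ _) ij)) edges)

  copyMatching : List (Fin (n X) × Fin (n X)) → List (Vertex × Vertex)
  copyMatching M = concatMap (λ v → map (liftEdge v) M) (allFin (n H))

  length-copyMatching : ∀ M → length (copyMatching M) ≡ n H * length M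
  length-copyMatching M = length-blockwise (λ v → map (liftEdge v) M) (λ v → length-map (liftEdge v) M)

  copyMatching-matching : ∀ {M} → IsMatching X M → IsMatching (corona H X) (copyMatching M)
  copyMatching-matching {M} (edges , uniq) = blockwise-matching _ (λ v → liftEdges-adjacent v edges)
    (λ v → endpoints-liftEdges v M) (Uniqueₚ.map⁺ Finₚ.suc-injective uniq)

  hubEdge+copyMatching-matching : ∀ {u w M} → adj H u w ≡ true → IsMatching X M →
    IsMatching (corona H X) ((vertex u zero , vertex w zero) ∷ copyMatching M)
  hubEdge+copyMatching-matching {u} {w} {M} uw matchM@(_ , uniq) =
    (trans (adj-vertex u zero w zero) uw ∷ proj₁ (copyMatching-matching matchM)) ,
    ((u₀≢w₀ ∷ avoids u) ∷ (avoids w ∷ proj₂ (copyMatching-matching matchM)))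
    where
      endpoints≡ : endpoints (copyMatching M) ≡ everyBlock (map suc (endpoints M))
      endpoints≡ = endpoints-blockwise _ (λ v → endpoints-liftEdges v M)
      avoids : ∀ v → All (vertex v zero ≢_) (endpoints (copyMatching M))
      avoids v = All.tabulate λ p∈ v₀≡p →
        hub∉everyBlock-leaves v (subst (_∈ everyBlock _) (sym v₀≡p) (subst (_ ∈_) endpoints≡ p∈))
      u₀≢w₀ : vertex u zero ≢ vertex w zero
      u₀≢w₀ u₀≡w₀ with proj₁ (vertex-injective u₀≡w₀)
      ... | refl = contradiction (trans (sym uw) (irrefl H u)) true≢false

  pendantMatching : Fin (n X) → List (Fin (n X) × Fin (n X)) → List (Vertex × Vertex)
  pendantMatching r M = concatMap (λ v → (vertex v zero , vertex v (suc r)) ∷ map (liftEdge v) M) (allFin (n H))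

  length-pendantMatching : ∀ r M → length (pendantMatching r M) ≡ n H * suc (length M)
  length-pendantMatching r M = length-blockwise _ (λ v → cong suc (length-map (liftEdge v) M))

  pendantMatching-matching : ∀ {r M} → IsMatching X M → r ∉ endpoints M →
    IsMatching (corona H X) (pendantMatching r M)
  pendantMatching-matching {r} {M} (edges , uniq) r∉M = blockwise-matching _
    (λ v → trans (adj-vertex v zero v (suc r)) (∼-hub-leaf v r) ∷ liftEdges-adjacent v edges)
    (λ v → cong (λ E → vertex v zero ∷ vertex v (suc r) ∷ E) (endpoints-liftEdges v M))
    (Allₚ.map⁺ (All.tabulate (λ _ ())) ∷
      Uniqueₚ.map⁺ Finₚ.suc-injective (Allₚ.¬Any⇒All¬ _ r∉M ∷ uniq))

  TouchesHub : Vertex × Vertex → Set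
  TouchesHub e = position (proj₁ e) ≡ zero ⊎ position (proj₂ e) ≡ zero

  touchesHub? : Decidable TouchesHub
  touchesHub? e = (position (proj₁ e) Fin.≟ zero) ⊎-dec (position (proj₂ e) Fin.≟ zero)

  hub-touching-matching-bound : ∀ {M} → IsMatching (corona H X) M → All TouchesHub M → length M ≤ n H
  -- Choosing a hub endpoint of each edge is injective, and a hub is determined by its block.
  hub-touching-matching-bound {M} (_ , uniq) touching = begin
    length M             ≡⟨ length-map hubEnd M ⟨
    length (map hubEnd M) ≤⟨ length≤-injectiveOn block
                              (λ p-hub q-hub block≡ → coordinates-injective block≡ (trans p-hub (sym q-hub)))
                              (Unique-map-endpoint hubEnd hubEnd-endpoint M uniq)
                              (Allₚ.map⁺ (All.map hubEnd-hub touching)) ⟩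
    n H                  ∎
    where
      open ≤-Reasoning
      hubEnd : Vertex × Vertex → Vertex
      hubEnd (p , q) with position p Fin.≟ zero
      ... | yes _ = p
      ... | no  _ = q
      hubEnd-endpoint : ∀ e → hubEnd e ≡ proj₁ e ⊎ hubEnd e ≡ proj₂ e
      hubEnd-endpoint (p , q) with position p Fin.≟ zero
      ... | yes _ = inj₁ refl
      ... | no  _ = inj₂ refl
      hubEnd-hub : ∀ {e} → TouchesHub e → position (hubEnd e) ≡ zero
      hubEnd-hub {p , q} touches with position p Fin.≟ zero | touches
      ... | yes p-hub | _          = p-hub
      ... | no  p≢hub | inj₁ p-hub = contradiction p-hub p≢hub
      ... | no  _     | inj₂ q-hub = q-hub

  edgeless-edge-within-block : (∀ v w → adj H v w ≡ false) → ∀ {p q} →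
    adj (corona H X) p q ≡ true → block p ≡ block q
  edgeless-edge-within-block edgeless {p} {q} pq
    with ∼-edge-within-block (block p) (position p) (block q) (position q) pq
  ... | inj₂ block≡ = block≡
  ... | inj₁ (p-hub , q-hub) = contradiction
    (trans (sym pq) (trans (adj-at refl p-hub refl q-hub) (edgeless (block p) (block q))))
    true≢false

  edgeless-matching-bound : (∀ v w → adj H v w ≡ false) → ∀ {c} → n X ≡ 2 * c →
    ∀ {M} → IsMatching (corona H X) M → length M ≤ n H * c
  edgeless-matching-bound edgeless {c} x≡2c = blockwise⇒length≤ (block ∘ proj₁) (IsMatching (corona H X))
    (IsMatching-filter (corona H X)) c in-block
    where
      in-block : ∀ v {T} → IsMatching (corona H X) T → All (λ e → block (proj₁ e) ≡ v) T → length T ≤ c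
      in-block v {T} (edges , uniq) T⊆v = 2*m≤1+2*n⇒m≤n (begin
        2 * length T           ≡⟨ length-endpoints T ⟨
        length (endpoints T)   ≤⟨ length≤-injectiveOn position
                                    (λ p∈v q∈v → coordinates-injective (trans p∈v (sym q∈v)))
                                    uniq (All-endpoints (All.zipWith both-in-v (T⊆v , edges))) ⟩
        suc (n X)              ≡⟨ cong suc x≡2c ⟩
        suc (2 * c)            ∎)
        where
          open ≤-Reasoning
          both-in-v : ∀ {e} → block (proj₁ e) ≡ v × adj (corona H X) (proj₁ e) (proj₂ e) ≡ true →
            block (proj₁ e) ≡ v × block (proj₂ e) ≡ v
          both-in-v (e₁∈v , e₁e₂) =
            e₁∈v , trans (sym (edgeless-edge-within-block edgeless e₁e₂)) e₁∈v

  module _ (x≥1 : n X ≥ 1) where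

    private
      unsuc : Fin K → Fin (n X)
      unsuc zero    = Fin.fromℕ< x≥1  -- junk value; unsuc is only applied to leaf positions
      unsuc (suc i) = i

      suc-unsuc : ∀ {a : Fin K} → a ≢ zero → suc (unsuc a) ≡ a
      suc-unsuc {zero}  a≢0 = contradiction refl a≢0
      suc-unsuc {suc i} _   = refl

    leafOf : Vertex → Fin (n X)
    leafOf = unsuc ∘ position

    LeafIn : Fin (n H) → Vertex → Set
    LeafIn v p = block p ≡ v × position p ≢ zero

    leafOf-injective : ∀ {v p q} → LeafIn v p → LeafIn v q → leafOf p ≡ leafOf q → p ≡ q
    leafOf-injective (p∈v , p≢hub) (q∈v , q≢hub) leaf≡ = coordinates-injective (trans p∈v (sym q∈v))
      (trans (sym (suc-unsuc p≢hub)) (trans (cong suc leaf≡) (suc-unsuc q≢hub)))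

    adj-leaves : ∀ {v p q} → LeafIn v p → LeafIn v q → adj (corona H X) p q ≡ adj X (leafOf p) (leafOf q)
    adj-leaves {v} (p∈v , p≢hub) (q∈v , q≢hub) = trans
      (adj-at p∈v (sym (suc-unsuc p≢hub)) q∈v (sym (suc-unsuc q≢hub)))
      (∼-leaves v _ _)

    independent-with-hub : ∀ {v T p₀} → IsIndependent (corona H X) T → All (λ p → block p ≡ v) T →
      p₀ ∈ T → position p₀ ≡ zero → length T ≤ 1
    independent-with-hub {v} {T} {p₀} (uniqT , indT) T⊆v p₀∈T p₀-hub =
      length≤-injectiveOn {k = 1} (λ _ → zero) (λ p≡p₀ q≡p₀ _ → trans p≡p₀ (sym q≡p₀))
        uniqT (All.tabulate equals-hub)
      where
        equals-hub : ∀ {q} → q ∈ T → q ≡ p₀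
        equals-hub {q} q∈T with position q in q-position
        ... | zero  = coordinates-injective (trans (All.lookup T⊆v q∈T) (sym (All.lookup T⊆v p₀∈T)))
                        (trans q-position (sym p₀-hub))
        ... | suc j = contradiction
          (trans (sym (∼-hub-leaf v j)) (trans
            (sym (adj-at (All.lookup T⊆v p₀∈T) p₀-hub (All.lookup T⊆v q∈T) q-position))
            (indT p₀ q p₀∈T q∈T)))
          true≢false

    independent-of-leaves : ∀ {a} → IsIndependenceNumber X a → ∀ {v T} →
      IsIndependent (corona H X) T → All (LeafIn v) T → length T ≤ a
    independent-of-leaves {a} α {v} {T} (uniqT , indT) leaves = begin
      length T              ≡⟨ length-map leafOf T ⟨
      length (map leafOf T) ≤⟨ proj₂ α (map leafOf T) (uniq , indep) ⟩
      a                     ∎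
      where
        open ≤-Reasoning
        uniq : Unique (map leafOf T)
        uniq = Unique-map-injectiveOn leafOf leafOf-injective uniqT leaves
        indep : ∀ i j → i ∈ map leafOf T → j ∈ map leafOf T → adj X i j ≡ false
        indep i j i∈ j∈ with ∈-map⁻ leafOf i∈ | ∈-map⁻ leafOf j∈
        ... | p , p∈T , refl | q , q∈T , refl =
          trans (sym (adj-leaves (All.lookup leaves p∈T) (All.lookup leaves q∈T))) (indT p q p∈T q∈T)

    independent-in-block : ∀ {a} → IsIndependenceNumber X a → ∀ v {T} →
      IsIndependent (corona H X) T → All (λ p → block p ≡ v) T → length T ≤ a
    independent-in-block α v {T} indT T⊆v with Any.any? (λ p → position p Fin.≟ zero) T
    ... | yes hub∈T = let (p₀ , p₀∈T , p₀-hub) = find hub∈T in ≤-trans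
      (independent-with-hub indT T⊆v p₀∈T p₀-hub)
      (proj₂ α (unsuc zero ∷ []) (singleton-independent X (unsuc zero)))
    ... | no no-hub = independent-of-leaves α indT (All.zip (T⊆v , Allₚ.¬Any⇒All¬ T no-hub))

    independenceNumber-corona : ∀ {a} → IsIndependenceNumber X a → IsIndependenceNumber (corona H X) (n H * a)
    independenceNumber-corona {a} α@((S , indS , |S|≡a) , _) =
      (everyBlock (map suc S) , copies-independent indS , |copies|≡) ,
      λ T indT → blockwise⇒length≤ block (IsIndependent (corona H X)) (IsIndependent-filter (corona H X))
                   a (independent-in-block α) indT
      where
        |copies|≡ : length (everyBlock (map suc S)) ≡ n H * a
        |copies|≡ = trans (length-everyBlock (map suc S)) (cong (n H *_) (trans (length-map suc S) |S|≡a))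

    leaf-edge-within-block : ∀ {p q} → position p ≢ zero → position q ≢ zero →
      adj (corona H X) p q ≡ true → block p ≡ block q
    leaf-edge-within-block p≢hub q≢hub pq = proj₁ (∼-leaf-edge _ _ _ _
      (trans (sym (adj-at refl (sym (suc-unsuc p≢hub)) refl (sym (suc-unsuc q≢hub)))) pq))

    leaf-matching-in-block : ∀ {m} → IsMatchingNumber X m → ∀ v {T} →
      IsMatching (corona H X) T × All (¬_ ∘ TouchesHub) T → All (λ e → block (proj₁ e) ≡ v) T →
      length T ≤ m
    leaf-matching-in-block {m} μ v {T} ((edges , uniq) , leafEdges) T⊆v = begin
      length T                     ≡⟨ length-map (mapEdge leafOf) T ⟨
      length (map (mapEdge leafOf) T) ≤⟨ proj₂ μ (map (mapEdge leafOf) T) (edgesX , uniqX) ⟩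
      m                            ∎
      where
        open ≤-Reasoning
        leaves : ∀ {e} → (block (proj₁ e) ≡ v × ¬ TouchesHub e) × adj (corona H X) (proj₁ e) (proj₂ e) ≡ true →
          LeafIn v (proj₁ e) × LeafIn v (proj₂ e)
        leaves {e} ((e₁∈v , leafEdge) , e₁e₂) = (e₁∈v , e₁≢hub) , (trans (sym same-block) e₁∈v , e₂≢hub)
          where
            e₁≢hub : position (proj₁ e) ≢ zero
            e₁≢hub = leafEdge ∘ inj₁
            e₂≢hub : position (proj₂ e) ≢ zero
            e₂≢hub = leafEdge ∘ inj₂
            same-block : block (proj₁ e) ≡ block (proj₂ e)
            same-block = leaf-edge-within-block e₁≢hub e₂≢hub e₁e₂
        leavesT : All (λ e → LeafIn v (proj₁ e) × LeafIn v (proj₂ e)) T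
        leavesT = All.map leaves (All.zip (All.zip (T⊆v , leafEdges) , edges))
        edgesX : All (λ e → adj X (proj₁ e) (proj₂ e) ≡ true) (map (mapEdge leafOf) T)
        edgesX = Allₚ.map⁺
          (All.zipWith (λ ((e₁ , e₂) , e₁e₂) → trans (sym (adj-leaves e₁ e₂)) e₁e₂) (leavesT , edges))
        uniqX : Unique (endpoints (map (mapEdge leafOf) T))
        uniqX = subst Unique (sym (endpoints-map leafOf T))
          (Unique-map-injectiveOn leafOf leafOf-injective uniq (All-endpoints leavesT))

    matching-bound : ∀ {m} → IsMatchingNumber X m →
      ∀ {M} → IsMatching (corona H X) M → length M ≤ n H * suc m
    matching-bound {m} μ {M} matchM = begin
      length M                                                       ≡⟨ length-filter-split touchesHub? M ⟩
      length (filter touchesHub? M) + length (filter (¬? ∘ touchesHub?) M) ≤⟨ +-mono-≤ hub-edges leaf-edges ⟩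
      n H + n H * m                                                  ≡⟨ *-suc (n H) m ⟨
      n H * suc m                                                    ∎
      where
        open ≤-Reasoning
        hub-edges : length (filter touchesHub? M) ≤ n H
        hub-edges = hub-touching-matching-bound (IsMatching-filter (corona H X) touchesHub? matchM)
          (Allₚ.all-filter touchesHub? M)
        leaf-edges : length (filter (¬? ∘ touchesHub?) M) ≤ n H * m
        leaf-edges = blockwise⇒length≤ (block ∘ proj₁)
          (λ T → IsMatching (corona H X) T × All (¬_ ∘ TouchesHub) T)
          (λ P? (matchT , leafT) → IsMatching-filter (corona H X) P? matchT , Allₚ.filter⁺ P? leafT)
          m (leaf-matching-in-block μ)
          (IsMatching-filter (corona H X) (¬? ∘ touchesHub?) matchM , Allₚ.all-filter (¬? ∘ touchesHub?) M)

    matchingNumber-corona-imperfect : ∀ {m} → IsMatchingNumber X m → 2 * m < n X →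
      IsMatchingNumber (corona H X) (n H * suc m)
    matchingNumber-corona-imperfect {m} μ@((M , matchM , |M|≡m) , _) 2m<x
      with length<⇒∃∉ (endpoints M) (subst (_< n X) (sym (trans (length-endpoints M) (cong (2 *_) |M|≡m))) 2m<x)
    ... | r , r∉M = (pendantMatching r M , pendantMatching-matching matchM r∉M ,
                     trans (length-pendantMatching r M) (cong (λ k → n H * suc k) |M|≡m)) ,
                    λ _ → matching-bound μ

-- The 1-König–Egerváry property of H ∘ X

one-block-arithmetic : ∀ a m x → suc (1 * a + 1 * suc m) ≡ 1 * suc x ⇔ suc (a + m) ≡ x
one-block-arithmetic a m x rewrite *-identityˡ a | *-identityˡ (suc m) | *-identityˡ (suc x) = mk⇔
  (λ eq → trans (sym (+-suc a m)) (suc-injective eq))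
  (λ eq → cong suc (trans (+-suc a m) eq))

imperfect-arithmetic : ∀ {h a m x} → suc (h * a + h * suc m) ≡ h * suc x ⇔ (h ≡ 1 × suc (a + m) ≡ x)
imperfect-arithmetic {h} {a} {m} {x} = mk⇔
  (λ eq → let h≡1 = h≡1 eq in
    h≡1 , to (one-block-arithmetic a m x) (subst (λ k → suc (k * a + k * suc m) ≡ k * suc x) h≡1 eq))
  (λ { (refl , eq) → from (one-block-arithmetic a m x) eq })
  where
    open Equivalence
    h≡1 : suc (h * a + h * suc m) ≡ h * suc x → h ≡ 1
    h≡1 eq = ∣1⇒≡1 (∣m+n∣m⇒∣n (subst (h ∣_) (trans (sym eq) (+-comm 1 _)) (m∣m*n (suc x)))
                              (∣m∣n⇒∣m+n (m∣m*n a) (m∣m*n (suc m))))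

1≤h≤2⇒h≡1⊎h≡2 : ∀ {h} → 1 ≤ h → h ≤ 2 → h ≡ 1 ⊎ h ≡ 2
1≤h≤2⇒h≡1⊎h≡2 {1}                 _ _ = inj₁ refl
1≤h≤2⇒h≡1⊎h≡2 {2}                 _ _ = inj₂ refl
1≤h≤2⇒h≡1⊎h≡2 {suc (suc (suc _))} _ (s≤s (s≤s ()))

perfect-arithmetic : ∀ {h a m μ} → a ≤ m → 2 * μ ≤ h * suc (2 * m) →
  suc (h * a + μ) ≡ h * suc (2 * m) → (h ≡ 1 ⊎ h ≡ 2) × a ≡ m
perfect-arithmetic {zero} _ _ ()
perfect-arithmetic {h@(suc _)} {a} {m} {μ} a≤m 2μ≤N eq =
  h≡1⊎h≡2 , ≤-antisym a≤m (m≤a h≡1⊎h≡2 N≤2+2ha)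
  where
    open ≤-Reasoning
    N : ℕ
    N = h * suc (2 * m)
    double : ∀ s μ → suc (s + μ) + suc (s + μ) ≡ (2 + 2 * s) + 2 * μ
    double = solve-∀
    swap : ∀ h m → 2 * (h * m) ≡ h * (2 * m)
    swap = solve-∀
    N≤2+2ha : N ≤ 2 + 2 * (h * a)
    N≤2+2ha = +-cancelʳ-≤ N N (2 + 2 * (h * a)) (begin
      N + N                            ≡⟨ cong (λ t → t + t) eq ⟨
      suc (h * a + μ) + suc (h * a + μ) ≡⟨ double (h * a) μ ⟩
      (2 + 2 * (h * a)) + 2 * μ        ≤⟨ +-monoʳ-≤ (2 + 2 * (h * a)) 2μ≤N ⟩
      (2 + 2 * (h * a)) + N            ∎)
    h≤2 : h ≤ 2
    h≤2 = +-cancelʳ-≤ (h * (2 * m)) h 2 (begin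
      h + h * (2 * m)      ≡⟨ *-suc h (2 * m) ⟨
      N                    ≤⟨ N≤2+2ha ⟩
      2 + 2 * (h * a)      ≤⟨ +-monoʳ-≤ 2 (*-monoʳ-≤ 2 (*-monoʳ-≤ h a≤m)) ⟩
      2 + 2 * (h * m)      ≡⟨ cong (2 +_) (swap h m) ⟩
      2 + h * (2 * m)      ∎)
    h≡1⊎h≡2 : h ≡ 1 ⊎ h ≡ 2
    h≡1⊎h≡2 = 1≤h≤2⇒h≡1⊎h≡2 (s≤s z≤n) h≤2
    m≤a : ∀ {h} → h ≡ 1 ⊎ h ≡ 2 → h * suc (2 * m) ≤ 2 + 2 * (h * a) → m ≤ a
    m≤a (inj₁ refl) N≤ = 2*m≤1+2*n⇒m≤n (s≤s⁻¹
      (subst₂ _≤_ (*-identityˡ _) (cong (λ t → 2 + 2 * t) (*-identityˡ a)) N≤))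
    m≤a (inj₂ refl) N≤ = *-cancelˡ-≤ 2 (*-cancelˡ-≤ 2 (+-cancelˡ-≤ 2 _ _
      (subst (_≤ 2 + 2 * (2 * a)) (*-suc 2 (2 * m)) N≤)))

two-blocks-excess : ∀ {h a m μ} → h ≡ 2 → a ≡ m → suc (h * a + μ) ≡ h * suc (2 * m) → h * m < μ
two-blocks-excess {m = m} {μ} refl refl eq =
  ≤-reflexive (sym (+-cancelˡ-≡ (2 * m) μ (suc (2 * m)) (suc-injective (trans eq (double m)))))
  where
    double : ∀ m → 2 * suc (2 * m) ≡ suc (2 * m + suc (2 * m))
    double = solve-∀

one-block-perfect : ∀ {h a m x} → h ≡ 1 → x ≡ 2 * m → a ≡ m → suc (h * a + h * m) ≡ h * suc x
one-block-perfect {m = m} refl refl refl = identity m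
  where
    identity : ∀ m → suc (1 * m + 1 * m) ≡ 1 * suc (2 * m)
    identity = solve-∀

two-blocks-perfect : ∀ {h a m x} → h ≡ 2 → x ≡ 2 * m → a ≡ m → suc (h * a + suc (h * m)) ≡ h * suc x
two-blocks-perfect {m = m} refl refl refl = identity m
  where
    identity : ∀ m → suc (2 * m + suc (2 * m)) ≡ 2 * suc (2 * m)
    identity = solve-∀

two-elements-cover : ∀ {k} → k ≡ 2 → ∀ {u w : Fin k} → u ≢ w → ∀ v → v ≡ u ⊎ v ≡ w
two-elements-cover refl {zero}     {zero}     u≢w _          = contradiction refl u≢w
two-elements-cover refl {zero}     {suc zero} _   zero       = inj₁ refl
two-elements-cover refl {zero}     {suc zero} _   (suc zero) = inj₂ refl
two-elements-cover refl {suc zero} {zero}     _   zero       = inj₂ refl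
two-elements-cover refl {suc zero} {zero}     _   (suc zero) = inj₁ refl
two-elements-cover refl {suc zero} {suc zero} u≢w _          = contradiction refl u≢w

two-distinct-elements : ∀ {k} → k ≡ 2 → Σ[ u ∈ Fin k ] Σ[ w ∈ Fin k ] u ≢ w
two-distinct-elements refl = zero , suc zero , λ ()

two-vertices-nonadjacent⇒edgeless : ∀ (Y : Graph) → n Y ≡ 2 → ∀ {u w} → u ≢ w → adj Y u w ≡ false →
  ∀ v v′ → adj Y v v′ ≡ false
two-vertices-nonadjacent⇒edgeless Y n≡2 u≢w uw v v′
  with two-elements-cover n≡2 u≢w v | two-elements-cover n≡2 u≢w v′
... | inj₁ refl | inj₁ refl = irrefl Y v
... | inj₁ refl | inj₂ refl = uw
... | inj₂ refl | inj₁ refl = trans (adj-sym Y v v′) uw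
... | inj₂ refl | inj₂ refl = irrefl Y v

module OneKECorona (H X : Graph) (x≥1 : n X ≥ 1) {a m : ℕ}
             (α : IsIndependenceNumber X a) (μ : IsMatchingNumber X m) where

  open Corona H X

  private
    αG : IsIndependenceNumber (corona H X) (n H * a)
    αG = independenceNumber-corona x≥1 α

    M₀ : List (Fin (n X) × Fin (n X))
    M₀ = proj₁ (proj₁ μ)

    matchM₀ : IsMatching X M₀
    matchM₀ = proj₁ (proj₂ (proj₁ μ))

    |copy|≡hm : length (copyMatching M₀) ≡ n H * m
    |copy|≡hm = trans (length-copyMatching M₀) (cong (n H *_) (proj₂ (proj₂ (proj₁ μ))))

  imperfect-1KE⇔ : 2 * m ≢ n X → Is1KE (corona H X) ⇔ (n H ≡ 1 × Is1KE X)
  imperfect-1KE⇔ 2m≢x = mk⇔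
    (λ 1KE → let (h≡1 , eq) = to arithmetic (to 1KE-G⇔ 1KE) in h≡1 , from 1KE-X⇔ eq)
    (λ (h≡1 , 1KE) → from 1KE-G⇔ (from arithmetic (h≡1 , to 1KE-X⇔ 1KE)))
    where
      open Equivalence
      arithmetic : suc (n H * a + n H * suc m) ≡ n H * suc (n X) ⇔ (n H ≡ 1 × suc (a + m) ≡ n X)
      arithmetic = imperfect-arithmetic
      1KE-X⇔ : Is1KE X ⇔ suc (a + m) ≡ n X
      1KE-X⇔ = Is1KE⇔ X α μ
      μG : IsMatchingNumber (corona H X) (n H * suc m)
      μG = matchingNumber-corona-imperfect x≥1 μ (≤∧≢⇒< (2μ≤n X μ) 2m≢x)
      1KE-G⇔ : Is1KE (corona H X) ⇔ suc (n H * a + n H * suc m) ≡ n H * suc (n X)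
      1KE-G⇔ = Is1KE⇔ (corona H X) αG μG

  perfect-KE⇔ : 2 * m ≡ n X → IsKE X ⇔ a ≡ m
  perfect-KE⇔ 2m≡x = mk⇔
    (λ KE → +-cancelʳ-≡ m a m (trans (to KE-X⇔ KE) (trans (sym 2m≡x) (2*m≡m+m m))))
    (λ a≡m → from KE-X⇔ (trans (cong (_+ m) a≡m) (trans (sym (2*m≡m+m m)) 2m≡x)))
    where
      open Equivalence
      KE-X⇔ : IsKE X ⇔ a + m ≡ n X
      KE-X⇔ = IsKE⇔ X α μ
      2*m≡m+m : ∀ m → 2 * m ≡ m + m
      2*m≡m+m m = cong (m +_) (+-identityʳ m)

  perfect-1KE⇒ : 2 * m ≡ n X → Is1KE (corona H X) → (n H ≡ 1 ⊎ (n H ≡ 2 × IsComplete H)) × a ≡ m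
  perfect-1KE⇒ 2m≡x (a′ , μ′ , αG′ , μG′@((M′ , matchM′ , refl) , _) , eq) =
    conclude (perfect-arithmetic a≤m 2μ′≤N eq′)
    where
      eq′ : suc (n H * a + μ′) ≡ n H * suc (2 * m)
      eq′ = subst₂ (λ a″ x → suc (a″ + μ′) ≡ n H * suc x)
        (independenceNumber-unique (corona H X) αG′ αG) (sym 2m≡x) eq
      a≤m : a ≤ m
      a≤m = +-cancelʳ-≤ m a m
        (subst (a + m ≤_) (trans (sym 2m≡x) (cong (m +_) (+-identityʳ m))) (α+μ≤n X α μ))
      2μ′≤N : 2 * μ′ ≤ n H * suc (2 * m)
      2μ′≤N = subst (λ x → 2 * μ′ ≤ n H * suc x) (sym 2m≡x) (2μ≤n (corona H X) μG′)
      conclude : (n H ≡ 1 ⊎ n H ≡ 2) × a ≡ m → (n H ≡ 1 ⊎ (n H ≡ 2 × IsComplete H)) × a ≡ m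
      conclude (inj₁ h≡1 , a≡m) = inj₁ h≡1 , a≡m
      conclude (inj₂ h≡2 , a≡m) = inj₂ (h≡2 , complete) , a≡m
        where
          complete : IsComplete H
          complete u w u≢w with adj H u w in uw
          ... | true  = refl
          ... | false = contradiction
            (edgeless-matching-bound (two-vertices-nonadjacent⇒edgeless H h≡2 u≢w uw) (sym 2m≡x) matchM′)
            (<⇒≱ (two-blocks-excess h≡2 a≡m eq′))

  perfect-1KE⇐ : 2 * m ≡ n X → (n H ≡ 1 ⊎ (n H ≡ 2 × IsComplete H)) → a ≡ m → Is1KE (corona H X)
  perfect-1KE⇐ 2m≡x (inj₁ h≡1) a≡m = near-perfect⇒1KE (corona H X) αG
    (copyMatching-matching matchM₀) |copy|≡hm (≤-reflexive (cong (n H *_) a≡m))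
    (one-block-perfect h≡1 (sym 2m≡x) a≡m)
  perfect-1KE⇐ 2m≡x (inj₂ (h≡2 , complete)) a≡m =
    let (u , w , u≢w) = two-distinct-elements h≡2 in near-perfect⇒1KE (corona H X) αG
      (hubEdge+copyMatching-matching (complete u w u≢w) matchM₀) (cong suc |copy|≡hm)
      (m≤n⇒m≤1+n (≤-reflexive (cong (n H *_) a≡m)))
      (two-blocks-perfect h≡2 (sym 2m≡x) a≡m)

  perfect-1KE⇔ : 2 * m ≡ n X → Is1KE (corona H X) ⇔ ((n H ≡ 1 ⊎ (n H ≡ 2 × IsComplete H)) × IsKE X)
  perfect-1KE⇔ 2m≡x = mk⇔
    (λ 1KE → let (shape , a≡m) = perfect-1KE⇒ 2m≡x 1KE in shape , from (perfect-KE⇔ 2m≡x) a≡m)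
    (λ (shape , KE) → perfect-1KE⇐ 2m≡x shape (to (perfect-KE⇔ 2m≡x) KE))
    where open Equivalence

corollary2p11 : (H X : Graph) → n H ≥ 1 → n X ≥ 1 →
    (Is1KE (corona H X) ⇔
    ((n H ≡ 1 × ((Is1KE X × ¬ HasPerfectMatching X) ⊎ (IsKE X × HasPerfectMatching X)))
    ⊎ (n H ≡ 2 × IsComplete H × IsKE X × HasPerfectMatching X)))
corollary2p11 H X _ x≥1
  with independenceNumber-exists X | matchingNumber-exists X
... | a , α | m , μ with 2 * m ≟ n X
... | no 2m≢x = mk⇔
  (λ 1KE → let (h≡1 , 1KE-X) = to (imperfect-1KE⇔ 2m≢x) 1KE in inj₁ (h≡1 , inj₁ (1KE-X , ¬perfect)))
  λ { (inj₁ (h≡1 , inj₁ (1KE-X , _))) → from (imperfect-1KE⇔ 2m≢x) (h≡1 , 1KE-X)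
    ; (inj₁ (_ , inj₂ (_ , perfect)))   → contradiction perfect ¬perfect
    ; (inj₂ (_ , _ , _ , perfect))       → contradiction perfect ¬perfect }
  where
    open Equivalence
    open OneKECorona H X x≥1 α μ
    ¬perfect : ¬ HasPerfectMatching X
    ¬perfect = 2m≢x ∘ to (perfectMatching⇔2μ≡n X μ)
... | yes 2m≡x = mk⇔
  (λ 1KE → case to (perfect-1KE⇔ 2m≡x) 1KE of λ
    { (inj₁ h≡1 , KE)               → inj₁ (h≡1 , inj₂ (KE , perfect))
    ; (inj₂ (h≡2 , complete) , KE) → inj₂ (h≡2 , complete , KE , perfect) })
  λ { (inj₁ (_ , inj₁ (_ , ¬perfect)))   → contradiction perfect ¬perfect
    ; (inj₁ (h≡1 , inj₂ (KE , _)))       → from (perfect-1KE⇔ 2m≡x) (inj₁ h≡1 , KE)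
    ; (inj₂ (h≡2 , complete , KE , _))   → from (perfect-1KE⇔ 2m≡x) (inj₂ (h≡2 , complete) , KE) }
  where
    open Equivalence
    open OneKECorona H X x≥1 α μ
    perfect : HasPerfectMatching X
    perfect = from (perfectMatching⇔2μ≡n X μ) 2m≡x
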